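{- Let $\mathcal F\subseteq\mathcal P([n])$ be a diamond-saturated family with $\emptyset,[n]\notin\mathcal F$, let $\mathcal A$ be its set of minimal elements, and let $a_1,\dots,a_k$, $\mathcal A_1\supsetneq\dots\supsetneq\mathcal A_k$ and $A_1,\dots,A_k$ be obtained by the construction described in the context (for any admissible choices). Let $1\leq j\leq k$ and $T\in\mathcal A_j$. Then $A_l\cap T=\emptyset$ for all $1\leq l\leq j-1$.
   Context: $\mathcal P([n])$ is the power set of $[n]=\{1,\dots,n\}$ ordered by inclusion. A diamond is four distinct sets $D,P,Q,T$ with $D\subsetneq P\subsetneq T$, $D\subsetneq Q\subsetneq T$, $P,Q$ incomparable; $\mathcal F$ is diamond-saturated if it contains no diamond but $\mathcal F\cup\{S\}$ contains one for every $S\in\mathcal P([n])\setminus\mathcal F$. For a family $\mathcal G\subseteq\mathcal P([n])$ and $i\in[n]$ let $f(i,\mathcal G)=\{G\in\mathcal G:i\in G\}$ and $W(\mathcal G)=\{i\in[n]:f(i,\mathcal G)=\emptyset\}$. Construction: set $\mathcal A_1=\mathcal A$. For $i\geq1$, if $\mathcal A_i\neq\emptyset$ choose $a_i\in[n]\setminus W(\mathcal A_i)$ such that $f(a_i,\mathcal A_i)$ is an inclusion-minimal element of $\{f(j,\mathcal A_i):j\in[n]\setminus W(\mathcal A_i)\}$, and set $\mathcal A_{i+1}=\mathcal A_i\setminus f(a_i,\mathcal A_i)$; let $k$ be the last index with $\mathcal A_k\neq\emptyset$. For $1\leq i\leq k$ let $A_i=\{j\in[n]:f(j,\mathcal A_i)=f(a_i,\mathcal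 A_i)\}$. -}

module Defs where

open import Data.Nat using (ℕ; zero; suc; _<_)
open import Data.Fin using (Fin)
open import Data.Fin.Subset using (Subset; _∈_; _∉_; _⊆_; _⊂_; ⊥; ⊤)
open import Data.Product using (Σ; ∃; _×_; _,_)
open import Data.Sum using (_⊎_)
open import Data.Empty using () renaming (⊥ to Empty)
open import Relation.Nullary using (¬_)
open import Relation.Binary.PropositionalEquality using (_≡_; _≢_)

Family : ℕ → Set₁
Family n = Subset n → Set

_⊆F_ : ∀ {n} → Family n → Family n → Set
𝓖 ⊆F 𝓗 = ∀ G → 𝓖 G → 𝓗 G

_⊊F_ : ∀ {n} → Family n → Family n → Set
𝓖 ⊊F 𝓗 = 𝓖 ⊆F 𝓗 × ¬ (𝓗 ⊆F 𝓖)

_≡F_ : ∀ {n} → Family n → Family n → Set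
𝓖 ≡F 𝓗 = 𝓖 ⊆F 𝓗 × 𝓗 ⊆F 𝓖

EmptyF : ∀ {n} → Family n → Set
EmptyF 𝓖 = ∀ G → ¬ 𝓖 G

insert : ∀ {n} → Family n → Subset n → Family n
insert 𝓕 S X = 𝓕 X ⊎ X ≡ S

record Diamond {n} (𝓕 : Family n) : Set where
  field
    D P Q T : Subset n
    D∈ : 𝓕 D
    P∈ : 𝓕 P
    Q∈ : 𝓕 Q
    T∈ : 𝓕 T
    D≢P : D ≢ P
    D≢Q : D ≢ Q
    D≢T : D ≢ T
    P≢Q : P ≢ Q
    P≢T : P ≢ T
    Q≢T : Q ≢ T
    D⊂P : D ⊂ P
    P⊂T : P ⊂ T
    D⊂Q : D ⊂ Q
    Q⊂T : Q ⊂ T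
    P⊈Q : ¬ (P ⊆ Q)
    Q⊈P : ¬ (Q ⊆ P)

DiamondFree : ∀ {n} → Family n → Set
DiamondFree 𝓕 = ¬ Diamond 𝓕

DiamondSaturated : ∀ {n} → Family n → Set
DiamondSaturated 𝓕 =
  DiamondFree 𝓕 × (∀ S → ¬ 𝓕 S → Diamond (insert 𝓕 S))

Minimal : ∀ {n} → Family n → Family n
Minimal 𝓕 X = 𝓕 X × (∀ Y → 𝓕 Y → ¬ (Y ⊂ X))

f : ∀ {n} → Fin n → Family n → Family n
f i 𝓖 G = 𝓖 G × i ∈ G

InW : ∀ {n} → Fin n → Family n → Set
InW i 𝓖 = EmptyF (f i 𝓖)

-- The families of the construction, 0-indexed:
-- stage 𝓐 a 0 = 𝓐 (= 𝓐₁), stage 𝓐 a (suc i) = stage i ∖ f(a i, stage i).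
stage : ∀ {n} → Family n → (ℕ → Fin n) → ℕ → Family n
stage 𝓐 a zero = 𝓐
stage 𝓐 a (suc i) G = stage 𝓐 a i G × ¬ (f (a i) (stage 𝓐 a i) G)

-- The choices a 0, …, a (k-1) (the paper's a₁,…,a_k) are admissible
-- for the construction starting from 𝓐, with k the last index such that
-- the stage is nonempty (so stage k, the paper's 𝓐_{k+1}, is empty).
record Admissible {n} (𝓐 : Family n) (a : ℕ → Fin n) (k : ℕ) : Set where
  field
    nonempty : ∀ i → i < k → ∃ λ G → stage 𝓐 a i G
    notW     : ∀ i → i < k → ¬ InW (a i) (stage 𝓐 a i)
    minimal  : ∀ i → i < k → ∀ j → ¬ InW j (stage 𝓐 a i) →
                 ¬ (f j (stage 𝓐 a i) ⊊F f (a i) (stage 𝓐 a i))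
    final    : EmptyF (stage 𝓐 a k)

Aset : ∀ {n} → Family n → (ℕ → Fin n) → ℕ → Fin n → Set
Aset 𝓐 a i j = f j (stage 𝓐 a i) ≡F f (a i) (stage 𝓐 a i)

module Submission where

open import Defs
open import Data.Nat using (ℕ; _<_; suc; _≤′_; ≤′-refl; ≤′-step)
open import Data.Nat.Properties using (≤⇒≤′)
open import Data.Fin using (Fin)
open import Data.Fin.Subset using (Subset; _∉_; ⊥; ⊤)
open import Data.Product using (_,_; proj₁; proj₂)
open import Relation.Nullary using (¬_)

-- Every member of 𝓐_{l+1} avoids a_l, hence avoids every element of A_l,
-- and the later stages are contained in 𝓐_{l+1}.

stage-antitone : ∀ {n} (𝓐 : Family n) (a : ℕ → Fin n) {m j : ℕ} →
                 m ≤′ j → stage 𝓐 a j ⊆F stage 𝓐 a m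
stage-antitone 𝓐 a ≤′-refl     T T∈ = T∈
stage-antitone 𝓐 a (≤′-step p) T T∈ = stage-antitone 𝓐 a p T (proj₁ T∈)

Aset-∉-next-stage : ∀ {n} (𝓐 : Family n) (a : ℕ → Fin n) (l : ℕ) (x : Fin n) →
                    Aset 𝓐 a l x → (T : Subset n) → stage 𝓐 a (suc l) T → x ∉ T
Aset-∉-next-stage 𝓐 a l x (fx⊆fa , _) T (T∈l , T∉fa) x∈T =
  T∉fa (fx⊆fa T (T∈l , x∈T))

lemma3p2 : (n : ℕ) (𝓕 : Family n) → DiamondSaturated 𝓕 → ¬ 𝓕 ⊥ → ¬ 𝓕 ⊤ →
    (a : ℕ → Fin n) (k : ℕ) → Admissible (Minimal 𝓕) a k →
    (j : ℕ) → j < k → (T : Subset n) → stage (Minimal 𝓕) a j T →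
    (l : ℕ) → l < j → (x : Fin n) → Aset (Minimal 𝓕) a l x → x ∉ T
lemma3p2 n 𝓕 _ _ _ a k _ j _ T T∈j l l<j x x∈Al =
  Aset-∉-next-stage 𝓐 a l x x∈Al T (stage-antitone 𝓐 a (≤⇒≤′ l<j) T T∈j)
  where
  𝓐 = Minimal 𝓕
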